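{- Let $V$ be a vector space over $\mathbb{F}_q$ of dimension $2m$, $m\geq1$, and $Q$ a nondegenerate quadratic form on $V$ of type $-1$ (elliptic), with polarisation $B$. Let $v\in V$, let $M$ be a maximal singular subspace of $O^{ - }(2m,q)$, and write $U=\mathrm{Aff}(M)$. For $z\in V$ let $V_z$ be the set of neighbours of $z$ in $VO^{ - }(2m,q)$. Then $$|V_z\cap(v+U)|=\begin{cases} q^{m-1}-1, & z\in v+U;\\ q^{m-2}, & z\notin v+U^{\perp};\\ 0, & z\in v+(U^{\perp}\setminus U).\end{cases}$$
   Context: $B(x,y)=Q(x+y)-Q(x)-Q(y)$ and $S^{\perp}=\{x\in V: B(x,s)=0\ \forall s\in S\}$. The affine polar graph $VO^{ - }(2m,q)$ has vertex set $V$, distinct $x,y$ adjacent iff $Q(x-y)=0$. The polar space $O^{ - }(2m,q)$ (rank $m-1$) has as points the $1$-dimensional subspaces of $V$ on which $Q$ vanishes, and as singular subspaces the (sets of points of) subspaces on which $Q$ vanishes identically; a maximal singular subspace $M$ corresponds to a maximal totally singular subspace $\mathrm{Aff}(M)=\{x\in V: x\in p\text{ for some point }p\in M\}$, of vector dimension $m-1$. -}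

module Defs where

open import Level using (0ℓ)
open import Algebra.Bundles using (CommutativeRing)
open import Data.Nat using (ℕ; zero; suc)
open import Data.Fin using (Fin; zero; suc)
open import Data.List using (List; []; _∷_; _++_; map; length; filter)
open import Data.List.Relation.Unary.Any using (Any; here; there; any?)
open import Data.List.Relation.Unary.AllPairs using (AllPairs)
open import Data.List.Relation.Unary.Any.Properties using (map⁺; ++⁺ˡ; ++⁺ʳ)
open import Data.Product using (Σ; ∃; _×_; _,_; proj₁; proj₂)
open import Data.Vec.Functional using (Vector) renaming (_∷_ to _∷ᶠ_)
open import Relation.Nullary using (¬_; Dec; yes; no)
open import Relation.Nullary.Decidable using (_×-dec_; ¬?)
open import Relation.Binary using (Decidable)
open import Relation.Binary.PropositionalEquality using (_≡_)
import Data.Fin.Properties as FinP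

record FiniteField (q : ℕ) : Set₁ where
  field
    commRing : CommutativeRing 0ℓ 0ℓ
  open CommutativeRing commRing public
  field
    _≟_      : Decidable _≈_
    0≉1      : ¬ (0# ≈ 1#)
    inverse  : ∀ x → ¬ (x ≈ 0#) → ∃ λ y → x * y ≈ 1#
    elems          : List Carrier
    elems-complete : ∀ x → Any (x ≈_) elems
    elems-unique   : AllPairs (λ a b → ¬ (a ≈ b)) elems
    elems-length   : length elems ≡ q

module _ {q : ℕ} (F : FiniteField q) where
  open FiniteField F using (Carrier; _≈_; _+_; _*_; -_; 0#; _≟_; elems; elems-complete; refl; sym; trans; +-cong; *-cong)

  Vec : ℕ → Set
  Vec n = Vector Carrier n

  _≈ᵥ_ : ∀ {n} → Vec n → Vec n → Set
  x ≈ᵥ y = ∀ i → x i ≈ y i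

  _+ᵥ_ : ∀ {n} → Vec n → Vec n → Vec n
  (x +ᵥ y) i = x i + y i

  _-ᵥ_ : ∀ {n} → Vec n → Vec n → Vec n
  (x -ᵥ y) i = x i + (- y i)

  _·ᵥ_ : ∀ {n} → Carrier → Vec n → Vec n
  (a ·ᵥ x) i = a * x i

  0ᵥ : ∀ {n} → Vec n
  0ᵥ i = 0#

  sumF : (k : ℕ) → (Fin k → Carrier) → Carrier
  sumF zero    f = 0#
  sumF (suc k) f = f zero + sumF k (λ i → f (suc i))

  lincomb : ∀ {n k} → (Fin k → Vec n) → (Fin k → Carrier) → Vec n
  lincomb {k = k} u c j = sumF k (λ i → c i * u i j)

  InSpan : ∀ {n k} → (Fin k → Vec n) → Vec n → Set
  InSpan u x = ∃ λ c → x ≈ᵥ lincomb u c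

  InCoset : ∀ {n k} → Vec n → (Fin k → Vec n) → Vec n → Set
  InCoset v u x = ∃ λ c → x ≈ᵥ (v +ᵥ lincomb u c)

  module _ {n : ℕ} (Q : Vec n → Carrier) where

    polar : Vec n → Vec n → Carrier
    polar x y = Q (x +ᵥ y) + (- Q x) + (- Q y)

    record IsQuadraticForm : Set where
      field
        Q-cong  : ∀ {x y} → x ≈ᵥ y → Q x ≈ Q y
        Q-scale : ∀ a x → Q (a ·ᵥ x) ≈ (a * a) * Q x
        B-additive : ∀ x y w → polar (x +ᵥ y) w ≈ polar x w + polar y w
        B-homog    : ∀ a x w → polar (a ·ᵥ x) w ≈ a * polar x w

    Nondegenerate : Set
    Nondegenerate = ∀ x → (∀ y → polar x y ≈ 0#) → x ≈ᵥ 0ᵥ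

    LinIndep : ∀ {k} → (Fin k → Vec n) → Set
    LinIndep u = ∀ c → lincomb u c ≈ᵥ 0ᵥ → ∀ i → c i ≈ 0#

    TotSingular : ∀ {k} → (Fin k → Vec n) → Set
    TotSingular u = ∀ x → InSpan u x → Q x ≈ 0#

    HasTSSubspaceOfDim : ℕ → Set
    HasTSSubspaceOfDim d = Σ (Fin d → Vec n) λ u → LinIndep u × TotSingular u

    MaximalTotSingular : ∀ {k} → (Fin k → Vec n) → Set
    MaximalTotSingular u =
      TotSingular u ×
      (∀ k′ (w : Fin k′ → Vec n) → TotSingular w →
         (∀ x → InSpan u x → InSpan w x) → ∀ x → InSpan w x → InSpan u x)

    Perp : ∀ {k} → (Fin k → Vec n) → Vec n → Set
    Perp u x = ∀ s → InSpan u s → polar x s ≈ 0#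

    InPerpCoset : ∀ {k} → Vec n → (Fin k → Vec n) → Vec n → Set
    InPerpCoset v u x = ∃ λ y → Perp u y × (x ≈ᵥ (v +ᵥ y))

  -- elliptic (type −1) form on F^(2m): Witt index m − 1, i.e. there is a
  -- totally singular subspace of dimension m − 1 but none of dimension m
  Elliptic : (m : ℕ) → (Vec (2 Data.Nat.* m) → Carrier) → Set
  Elliptic m Q = HasTSSubspaceOfDim Q (m Data.Nat.∸ 1) × ¬ HasTSSubspaceOfDim Q m

  consAll : ∀ {n} → List Carrier → List (Vec n) → List (Vec (suc n))
  consAll []       vs = []
  consAll (a ∷ as) vs = map (a ∷ᶠ_) vs ++ consAll as vs

  allVecs : (n : ℕ) → List (Vec n)
  allVecs zero    = (λ ()) ∷ []
  allVecs (suc n) = consAll elems (allVecs n)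

  private
    consAll-complete : ∀ {n} (c : Vec (suc n)) as vs →
      Any (c zero ≈_) as → Any ((λ i → c (suc i)) ≈ᵥ_) vs →
      Any (c ≈ᵥ_) (consAll as vs)
    consAll-complete c (a ∷ as) vs (here e) r =
      ++⁺ˡ (map⁺ (Data.List.Relation.Unary.Any.map
        (λ eq → λ { zero → e ; (suc i) → eq i }) r))
    consAll-complete c (a ∷ as) vs (there p) r =
      ++⁺ʳ (map (a ∷ᶠ_) vs) (consAll-complete c as vs p r)

  allVecs-complete : ∀ n (c : Vec n) → Any (c ≈ᵥ_) (allVecs n)
  allVecs-complete zero    c = here (λ ())
  allVecs-complete (suc n) c =
    consAll-complete c elems (allVecs n) (elems-complete (c zero))
      (allVecs-complete n (λ i → c (suc i)))

  _≈ᵥ?_ : ∀ {n} (x y : Vec n) → Dec (x ≈ᵥ y)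
  x ≈ᵥ? y = FinP.all? (λ i → x i ≟ y i)

  private
    sumF-cong : ∀ k {f g : Fin k → Carrier} → (∀ i → f i ≈ g i) → sumF k f ≈ sumF k g
    sumF-cong zero    e = refl
    sumF-cong (suc k) e = +-cong (e zero) (sumF-cong k (λ i → e (suc i)))

    ≈ᵥ-trans : ∀ {n} {x y z : Vec n} → x ≈ᵥ y → y ≈ᵥ z → x ≈ᵥ z
    ≈ᵥ-trans p r i = trans (p i) (r i)

    InCoset-resp : ∀ {n k} (v : Vec n) (u : Fin k → Vec n) x {c d} → c ≈ᵥ d →
      x ≈ᵥ (v +ᵥ lincomb u d) → x ≈ᵥ (v +ᵥ lincomb u c)
    InCoset-resp {k = k} v u x c≈d p j =
      trans (p j) (+-cong refl (sumF-cong k (λ i → *-cong (sym (c≈d i)) refl)))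

    fromAny : ∀ {n k} (v : Vec n) (u : Fin k → Vec n) x cs →
      Any (λ c → x ≈ᵥ (v +ᵥ lincomb u c)) cs → InCoset v u x
    fromAny v u x (c ∷ cs) (here p)  = c , p
    fromAny v u x (c ∷ cs) (there p) = fromAny v u x cs p

    toAny : ∀ {n k} (v : Vec n) (u : Fin k → Vec n) x c cs →
      x ≈ᵥ (v +ᵥ lincomb u c) → Any (c ≈ᵥ_) cs →
      Any (λ d → x ≈ᵥ (v +ᵥ lincomb u d)) cs
    toAny v u x c (d ∷ cs) p (here e) = here (InCoset-resp v u x (λ i → sym (e i)) p)
    toAny v u x c (d ∷ cs) p (there q) = there (toAny v u x c cs p q)

  InCoset? : ∀ {n k} (v : Vec n) (u : Fin k → Vec n) x → Dec (InCoset v u x)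
  InCoset? {k = k} v u x
    with any? (λ c → x ≈ᵥ? (v +ᵥ lincomb u c)) (allVecs k)
  ... | yes p = yes (fromAny v u x (allVecs k) p)
  ... | no ¬p = no λ { (c , e) → ¬p (toAny v u x c (allVecs k) e (allVecs-complete k c)) }

  -- |V_z ∩ (v + span u)| : the number of vectors x of F^n with
  -- x ∈ v + span(u), x ≠ z and Q(z − x) = 0 (x adjacent to z in the
  -- affine polar graph).  Since allVecs n lists every vector exactly once
  -- (up to ≈ᵥ), this is the cardinality of the set.
  countNbrsInCoset : ∀ {n k} → (Vec n → Carrier) → Vec n → (Fin k → Vec n) →
                     Vec n → ℕ
  countNbrsInCoset {n} Q v u z =
    length (filter (λ x → InCoset? v u x ×-dec ¬? (x ≈ᵥ? z) ×-dec (Q (z -ᵥ x) ≟ 0#))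
                   (allVecs n))

-- Translating by v, the neighbours of z in v + U are the y ∈ U with y ≠ w and Q(w − y) = 0,
-- where w = z − v; as U is totally singular, Q(w − y) = Q(w) − B(w, y) for y ∈ U.  If w ∈ U this
-- vanishes identically, leaving |U| − 1 neighbours.  If w ∉ U^⊥, the condition B(w, y) = Q(w)
-- cuts out a fibre of the nonzero linear form B(w, ·) on U, of size |U|/q.  If w ∈ U^⊥ ∖ U,
-- then B(w, ·) vanishes on U while Q(w) ≠ 0 (else U + ⟨w⟩ would be totally singular), so there
-- are none.  Finally dim U = m − 1, because no totally singular W is longer than a maximal U:
-- counting would give a nonzero vector of W outside U ∩ W and orthogonal to U, which maximality
-- nevertheless forces into U.

module Submission where

open import Defs
open import Data.Nat using (ℕ; _≤_; _*_; _^_; _∸_)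
open import Data.Fin using (Fin)
open import Data.Product using (_×_)
open import Relation.Nullary using (¬_)
open import Relation.Binary.PropositionalEquality using (_≡_)

open import Level using (0ℓ)
import Data.Nat as ℕ
open import Data.Nat using (suc; z≤n; s≤s)
import Data.Nat.Properties as ℕₚ
open import Data.Fin using (zero; suc)
open import Data.Product using (∃; ∃-syntax; Σ-syntax; _,_; proj₁; proj₂)
open import Data.Sum using (inj₁; inj₂)
open import Data.Empty using (⊥; ⊥-elim)
open import Data.Unit using (⊤; tt)
open import Data.Vec.Functional using () renaming (_∷_ to _∷ᶠ_)
open import Data.List using (List; []; _∷_; _++_; map; length; filter; tabulate; lookup)
open import Data.List.Properties
  using (length-++; length-tabulate; length-map; length-removeAt′; filter-all; filter-none; filter-some)
open import Data.List.Relation.Unary.Any using (Any; here; there; any?; satisfied; index)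
import Data.List.Relation.Unary.Any as Any
open import Data.List.Relation.Unary.All using (All; []; _∷_; universal)
open import Data.List.Relation.Unary.AllPairs using ([]; _∷_)
import Data.List.Relation.Unary.All as All
import Data.List.Relation.Unary.All.Properties as All
open import Data.List.Membership.Setoid.Properties using (∈-filter⁺)
open import Function using (id; _∘_)
open import Relation.Nullary using (Dec; yes; no)
open import Relation.Nullary.Decidable using (_×-dec_; ¬?; decidable-stable)
open import Relation.Unary using (Pred; Decidable; _⊆_; _∩_)
open import Relation.Unary.Properties using (_∩?_; _∪?_; ∁?; U?)
open import Relation.Binary using (Setoid; _Respects_)
import Relation.Binary.PropositionalEquality as ≡

module _ {a} {A : Set a} where

  length-filter-mono : ∀ {p r} {P : Pred A p} {R : Pred A r} (P? : Decidable P) (R? : Decidable R) →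
    P ⊆ R → ∀ xs → length (filter P? xs) ≤ length (filter R? xs)
  length-filter-mono P? R? P⊆R [] = z≤n
  length-filter-mono P? R? P⊆R (x ∷ xs) with P? x | R? x
  ... | yes _  | yes _  = s≤s (length-filter-mono P? R? P⊆R xs)
  ... | yes px | no ¬rx = ⊥-elim (¬rx (P⊆R px))
  ... | no _   | yes _  = ℕₚ.m≤n⇒m≤1+n (length-filter-mono P? R? P⊆R xs)
  ... | no _   | no _   = length-filter-mono P? R? P⊆R xs

  length-filter-cong : ∀ {p r} {P : Pred A p} {R : Pred A r} (P? : Decidable P) (R? : Decidable R) →
    P ⊆ R → R ⊆ P → ∀ xs → length (filter P? xs) ≡ length (filter R? xs)
  length-filter-cong P? R? P⊆R R⊆P xs =
    ℕₚ.≤-antisym (length-filter-mono P? R? P⊆R xs) (length-filter-mono R? P? R⊆P xs)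

  length-filter-∪ : ∀ {p r} {P : Pred A p} {R : Pred A r} (P? : Decidable P) (R? : Decidable R) →
    (∀ {x} → P x → R x → ⊥) → ∀ xs →
    length (filter (P? ∪? R?) xs) ≡ length (filter P? xs) ℕ.+ length (filter R? xs)
  length-filter-∪ P? R? disjoint [] = ≡.refl
  length-filter-∪ P? R? disjoint (x ∷ xs) with P? x | R? x
  ... | yes px | yes rx = ⊥-elim (disjoint px rx)
  ... | yes _  | no _   = ≡.cong suc (length-filter-∪ P? R? disjoint xs)
  ... | no _   | yes _  = ≡.trans (≡.cong suc (length-filter-∪ P? R? disjoint xs))
                                (≡.sym (ℕₚ.+-suc (length (filter P? xs)) _))
  ... | no _   | no _   = length-filter-∪ P? R? disjoint xs

  length-filter-split : ∀ {p r} {P : Pred A p} {R : Pred A r} (P? : Decidable P) (R? : Decidable R) →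
    ∀ xs → length (filter P? xs) ≡ length (filter (P? ∩? R?) xs) ℕ.+ length (filter (P? ∩? ∁? R?) xs)
  length-filter-split P? R? [] = ≡.refl
  length-filter-split P? R? (x ∷ xs) with P? x | R? x
  ... | yes _ | yes _ = ≡.cong suc (length-filter-split P? R? xs)
  ... | yes _ | no _  = ≡.trans (≡.cong suc (length-filter-split P? R? xs)) (≡.sym (ℕₚ.+-suc _ _))
  ... | no _  | yes _ = length-filter-split P? R? xs
  ... | no _  | no _  = length-filter-split P? R? xs

module _ {c ℓ} (S : Setoid c ℓ) where
  open Setoid S
  open import Data.List.Membership.Setoid S using (_∈_; _─_)
  open import Data.List.Relation.Unary.Unique.Setoid S using (Unique)

  ∈-─ : ∀ {x y} ys (x∈ys : x ∈ ys) → y ∈ ys → ¬ x ≈ y → y ∈ ys ─ x∈ys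
  ∈-─ (_ ∷ _)  (here x≈)   (here y≈)   x≉y = ⊥-elim (x≉y (trans x≈ (sym y≈)))
  ∈-─ (_ ∷ _)  (here _)    (there y∈)  _   = y∈
  ∈-─ (_ ∷ _)  (there _)   (here y≈)   _   = here y≈
  ∈-─ (_ ∷ ys) (there x∈)  (there y∈)  x≉y = there (∈-─ ys x∈ y∈ x≉y)

  unique⊆⇒length≤ : ∀ {xs ys} → Unique xs → All (_∈ ys) xs → length xs ≤ length ys
  unique⊆⇒length≤ {[]}     _              _            = z≤n
  unique⊆⇒length≤ {x ∷ xs} {ys} (x≉xs ∷ u) (x∈ys ∷ xs⊆ys) =
    ≡.subst (suc (length xs) ≤_) (≡.sym (length-removeAt′ ys (index x∈ys)))
      (s≤s (unique⊆⇒length≤ u (All.zipWith (λ (x≉y , y∈ys) → ∈-─ ys x∈ys y∈ys x≉y) (x≉xs , xs⊆ys))))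

^-cancelʳ-≤ : ∀ m {a b} → 1 ℕ.< m → m ^ a ≤ m ^ b → a ≤ b
^-cancelʳ-≤ m 1<m m^a≤m^b = ℕₚ.≮⇒≥ (λ b<a → ℕₚ.<⇒≱ (ℕₚ.^-monoʳ-< m 1<m b<a) m^a≤m^b)

^-injectiveʳ : ∀ m {a b} → 1 ℕ.< m → m ^ a ≡ m ^ b → a ≡ b
^-injectiveʳ m 1<m m^a≡m^b =
  ℕₚ.≤-antisym (^-cancelʳ-≤ m 1<m (ℕₚ.≤-reflexive m^a≡m^b)) (^-cancelʳ-≤ m 1<m (ℕₚ.≤-reflexive (≡.sym m^a≡m^b)))

module FiniteVectorSpace {q : ℕ} (F : FiniteField q) where
  open FiniteField F renaming (_*_ to _·_) hiding (zero)
  open import Algebra.Properties.Ring ring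
    using (-1*x≈-x; -‿distribˡ-*; -‿distribʳ-*; -0#≈0#; -‿involutive; -‿+-comm; +-inverseˡ-unique; +-cancelʳ; x∙y⁻¹≈ε⇒x≈y; x≈y⇒x∙y⁻¹≈ε; //-rightDividesˡ; //-rightDividesʳ)
  open import Algebra.Properties.CommutativeSemigroup +-commutativeSemigroup using (interchange)
  open import Relation.Binary.Reasoning.Setoid setoid
  open import Data.List.Membership.Setoid setoid using () renaming (_∈_ to _∈ᶠ_)
  open import Data.List.Relation.Unary.Unique.Setoid setoid using () renaming (Unique to Uniqueᶠ)
  import Data.List.Relation.Unary.Any.Properties as AnyP
  import Data.List.Relation.Unary.Unique.Setoid.Properties as UniqueP

  V : ℕ → Set
  V n = Vec F n

  infix 4 _≈v_
  infixl 6 _+v_ _-v_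
  infixr 7 _·v_

  _≈v_ : ∀ {n} → V n → V n → Set
  _≈v_ = _≈ᵥ_ F

  _+v_ _-v_ : ∀ {n} → V n → V n → V n
  _+v_ = _+ᵥ_ F
  _-v_ = _-ᵥ_ F

  _·v_ : ∀ {n} → Carrier → V n → V n
  _·v_ = _·ᵥ_ F

  0v : ∀ {n} → V n
  0v = 0ᵥ F

  _≈v?_ : ∀ {n} (x y : V n) → Dec (x ≈v y)
  _≈v?_ = _≈ᵥ?_ F

  V-setoid : ℕ → Setoid 0ℓ 0ℓ
  V-setoid n = record
    { Carrier       = V n
    ; _≈_           = _≈v_
    ; isEquivalence = record
      { refl  = λ i → refl
      ; sym   = λ x≈y i → sym (x≈y i)
      ; trans = λ x≈y y≈z i → trans (x≈y i) (y≈z i)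
      }
    }

  module _ {n : ℕ} where
    open Setoid (V-setoid n) public using () renaming (refl to ≈v-refl; sym to ≈v-sym; trans to ≈v-trans)
    open import Data.List.Membership.Setoid (V-setoid n) public using (_∈_)
    open import Data.List.Relation.Unary.Unique.Setoid (V-setoid n) public using (Unique)

  allVecs-length : ∀ n → length (allVecs F n) ≡ q ^ n
  allVecs-length ℕ.zero    = ≡.refl
  allVecs-length (suc n) =
    ≡.trans (length-consAll elems) (≡.cong₂ _*_ elems-length (allVecs-length n))
    where
    length-consAll : ∀ as → length (consAll F as (allVecs F n)) ≡ length as * length (allVecs F n)
    length-consAll []       = ≡.refl
    length-consAll (a ∷ as) = ≡.trans (length-++ (map (a ∷ᶠ_) (allVecs F n)))
      (≡.cong₂ ℕ._+_ (length-map (a ∷ᶠ_) (allVecs F n)) (length-consAll as))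

  private
    head-∈ : ∀ {n} as (vs : List (V n)) {v : V (suc n)} → v ∈ consAll F as vs → v zero ∈ᶠ as
    head-∈ (a ∷ as) vs v∈ with AnyP.++⁻ (map (a ∷ᶠ_) vs) v∈
    ... | inj₁ v∈a∷vs = here (proj₂ (satisfied (AnyP.map⁻ v∈a∷vs)) zero)
    ... | inj₂ v∈rest = there (head-∈ as vs v∈rest)

    consAll-unique : ∀ {n} as (vs : List (V n)) → Uniqueᶠ as → Unique vs → Unique (consAll F as vs)
    consAll-unique []       vs _            _     = []
    consAll-unique (a ∷ as) vs (a≉as ∷ as!) vs! =
      UniqueP.++⁺ (V-setoid _)
        (UniqueP.map⁺ (V-setoid _) (V-setoid _) (λ a∷x≈a∷y i → a∷x≈a∷y (suc i)) vs!)
        (consAll-unique as vs as! vs!)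
        (λ (v∈a∷vs , v∈rest) → a∉as a≉as (proj₂ (satisfied (AnyP.map⁻ v∈a∷vs)) zero) (head-∈ as vs v∈rest))
      where
      a∉as : ∀ {b bs} → All (λ c → ¬ a ≈ c) bs → b ≈ a → b ∈ᶠ bs → ⊥
      a∉as (a≉c ∷ _)  b≈a (here b≈c)  = a≉c (trans (sym b≈a) b≈c)
      a∉as (_ ∷ a≉cs) b≈a (there b∈cs) = a∉as a≉cs b≈a b∈cs

  allVecs-unique : ∀ n → Unique (allVecs F n)
  allVecs-unique ℕ.zero  = [] ∷ []
  allVecs-unique (suc n) = consAll-unique elems (allVecs F n) elems-unique (allVecs-unique n)

  -- Counting subsets of F^n

  count : ∀ {n} {P : Pred (V n) 0ℓ} → Decidable P → ℕ
  count {n} P? = length (filter P? (allVecs F n))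

  module _ {n : ℕ} {P R : Pred (V n) 0ℓ} (P? : Decidable P) (R? : Decidable R) where

    count-mono : P ⊆ R → count P? ≤ count R?
    count-mono P⊆R = length-filter-mono P? R? P⊆R (allVecs F n)

    count-cong : P ⊆ R → R ⊆ P → count P? ≡ count R?
    count-cong P⊆R R⊆P = length-filter-cong P? R? P⊆R R⊆P (allVecs F n)

    count-∪ : (∀ {x} → P x → R x → ⊥) → count (P? ∪? R?) ≡ count P? ℕ.+ count R?
    count-∪ disjoint = length-filter-∪ P? R? disjoint (allVecs F n)

    count-split : count P? ≡ count (P? ∩? R?) ℕ.+ count (P? ∩? ∁? R?)
    count-split = length-filter-split P? R? (allVecs F n)

  count-none : ∀ {n} {P : Pred (V n) 0ℓ} (P? : Decidable P) → (∀ x → ¬ P x) → count P? ≡ 0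
  count-none {n} P? ¬P = ≡.cong length (filter-none P? (universal ¬P (allVecs F n)))

  count-all : ∀ n → count (U? {A = V n}) ≡ q ^ n
  count-all n = ≡.trans (≡.cong length (filter-all U? (universal _ (allVecs F n)))) (allVecs-length n)

  count-injective : ∀ {n m} {P : Pred (V n) 0ℓ} {R : Pred (V m) 0ℓ} (P? : Decidable P) (R? : Decidable R) →
    R Respects _≈v_ → (f : V n → V m) → (∀ {x} → P x → R (f x)) →
    (∀ {x y} → P x → P y → f x ≈v f y → x ≈v y) → count P? ≤ count R?
  count-injective {n} {m} {P} P? R? R-resp f f∈R f-inj =
    ≡.subst (_≤ count R?) (length-map f inP)
      (unique⊆⇒length≤ (V-setoid m)
        (image-unique inP (UniqueP.filter⁺ (V-setoid n) P? (allVecs-unique n)) (All.all-filter P? (allVecs F n)))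
        (All.map⁺ (All.map (λ {x} px → ∈-filter⁺ (V-setoid m) R? R-resp (allVecs-complete F m (f x)) (f∈R px))
                           (All.all-filter P? (allVecs F n)))))
    where
    inP = filter P? (allVecs F n)
    image-unique : ∀ xs → Unique xs → All P xs → Unique (map f xs)
    image-unique []       _            _          = []
    image-unique (x ∷ xs) (x≉xs ∷ xs!) (px ∷ pxs) =
      All.map⁺ (All.zipWith (λ (x≉y , py) fx≈fy → x≉y (f-inj px py fx≈fy)) (x≉xs , pxs)) ∷ image-unique xs xs! pxs

  count-singleton : ∀ {n} (z : V n) → count (_≈v? z) ≡ 1
  count-singleton {n} z = ℕₚ.≤-antisym
    (unique⊆⇒length≤ (V-setoid n) {ys = z ∷ []} (UniqueP.filter⁺ (V-setoid n) (_≈v? z) (allVecs-unique n))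
      (All.map here (All.all-filter (_≈v? z) (allVecs F n))))
    (filter-some (_≈v? z) (Any.map ≈v-sym (allVecs-complete F n z)))

  count-translate : ∀ {n} {P : Pred (V n) 0ℓ} (P? : Decidable P) → P Respects _≈v_ → (t : V n) →
    count (λ x → P? (x -v t)) ≡ count P?
  count-translate P? P-resp t = ℕₚ.≤-antisym
    (count-injective (λ x → P? (x -v t)) P? P-resp (_-v t) id
      (λ _ _ x-t≈y-t i → trans (sym (//-rightDividesˡ (t i) _)) (trans (+-cong (x-t≈y-t i) refl) (//-rightDividesˡ (t i) _))))
    (count-injective P? (λ x → P? (x -v t)) (λ x≈y → P-resp (λ i → +-cong (x≈y i) refl)) (_+v t)
      (P-resp (λ i → sym (//-rightDividesʳ (t i) _)))
      (λ _ _ x+t≈y+t i → trans (sym (//-rightDividesʳ (t i) _)) (trans (+-cong (x+t≈y+t i) refl) (//-rightDividesʳ (t i) _))))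

  count-⋃ : ∀ {n} {P : Carrier → Pred (V n) 0ℓ} (P? : ∀ a → Decidable (P a)) →
    (∀ {a b x} → P a x → P b x → a ≈ b) → ∀ {K} → (∀ a → count (P? a) ≡ K) →
    ∀ as → Uniqueᶠ as → count (λ x → any? (λ a → P? a x) as) ≡ length as * K
  count-⋃ P? _ _ [] _ = count-none (λ x → any? (λ a → P? a x) []) (λ _ ())
  count-⋃ {P = P} P? functional {K} count≡K (a ∷ as) (a≉as ∷ as!) =
    ≡.trans (count-cong _ (P? a ∪? Pas?) (λ { (here p) → inj₁ p ; (there p) → inj₂ p })
                                         (λ { (inj₁ p) → here p ; (inj₂ p) → there p }))
   (≡.trans (count-∪ (P? a) Pas? (not-in-rest a≉as))
            (≡.cong₂ ℕ._+_ (count≡K a) (count-⋃ P? functional count≡K as as!)))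
    where
    Pas? = λ x → any? (λ b → P? b x) as
    not-in-rest : ∀ {x bs} → All (λ b → ¬ a ≈ b) bs → P a x → Any (λ b → P b x) bs → ⊥
    not-in-rest (a≉b ∷ _)  pa (here pb)  = a≉b (functional pa pb)
    not-in-rest (_ ∷ a≉bs) pa (there pbs) = not-in-rest a≉bs pa pbs

  ∃? : ∀ {n} {P : Pred (V n) 0ℓ} → Decidable P → P Respects _≈v_ → Dec (∃ P)
  ∃? {n} P? P-resp with any? P? (allVecs F n)
  ... | yes p = yes (satisfied p)
  ... | no ¬p = no λ (x , px) → ¬p (Any.map (λ x≈y → P-resp x≈y px) (allVecs-complete F n x))

  pigeonhole : ∀ {n r} {P : Pred (V n) 0ℓ} (P? : Decidable P) → P Respects _≈v_ →
    (f : V n → V r) → (∀ {x y} → x ≈v y → f x ≈v f y) → q ^ r ℕ.< count P? →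
    ∃[ x ] ∃[ y ] P x × P y × ¬ x ≈v y × f x ≈v f y
  pigeonhole {n} {r} {P} P? P-resp f f-cong q^r<count with ∃? Collides? Collides-resp
    where
    Partner : V n → Pred (V n) 0ℓ
    Partner x y = P y × ¬ x ≈v y × f x ≈v f y
    Partner-resp : ∀ {x x′} → x ≈v x′ → ∀ {y y′} → y ≈v y′ → Partner x y → Partner x′ y′
    Partner-resp x≈x′ y≈y′ (py , x≉y , fx≈fy) =
      P-resp y≈y′ py , (λ x′≈y′ → x≉y (≈v-trans x≈x′ (≈v-trans x′≈y′ (≈v-sym y≈y′)))) ,
      ≈v-trans (f-cong (≈v-sym x≈x′)) (≈v-trans fx≈fy (f-cong y≈y′))
    Collides : Pred (V n) 0ℓ
    Collides x = P x × ∃ (Partner x)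
    Collides? : Decidable Collides
    Collides? x = P? x ×-dec ∃? (λ y → P? y ×-dec ¬? (x ≈v? y) ×-dec (f x ≈v? f y)) (Partner-resp ≈v-refl)
    Collides-resp : Collides Respects _≈v_
    Collides-resp x≈x′ (px , y , partner) = P-resp x≈x′ px , y , Partner-resp x≈x′ ≈v-refl partner
  ... | yes (x , px , y , partner) = x , y , px , partner
  ... | no ¬collision = ⊥-elim (ℕₚ.<⇒≱ q^r<count
          (≡.subst (count P? ≤_) (count-all r) (count-injective P? U? _ f _ injective)))
    where
    injective : ∀ {x y} → P x → P y → f x ≈v f y → x ≈v y
    injective {x} {y} px py fx≈fy with x ≈v? y
    ... | yes x≈y = x≈y
    ... | no x≉y  = ⊥-elim (¬collision (x , px , y , py , x≉y , fx≈fy))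

  1<q : 1 ℕ.< q
  1<q = ≡.subst (2 ≤_) elems-length
    (unique⊆⇒length≤ setoid {0# ∷ 1# ∷ []} ((0≉1 ∷ []) ∷ [] ∷ []) (elems-complete 0# ∷ elems-complete 1# ∷ []))

  x-0*y≈x : ∀ x y → x + - (0# · y) ≈ x
  x-0*y≈x x y = trans (+-cong refl (trans (-‿cong (zeroˡ y)) -0#≈0#)) (+-identityʳ x)

  x-1*x≈0 : ∀ x → x + - (1# · x) ≈ 0#
  x-1*x≈0 x = trans (+-cong refl (-‿cong (*-identityˡ x))) (-‿inverseʳ x)

  [a-b]-[c-d]≈[a-c]+[d-b] : ∀ a b c d → (a + - b) + - (c + - d) ≈ (a + - c) + (d + - b)
  [a-b]-[c-d]≈[a-c]+[d-b] a b c d = begin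
    (a + - b) + - (c + - d)   ≈⟨ +-cong refl (-‿+-comm c (- d)) ⟨
    (a + - b) + (- c + - - d) ≈⟨ interchange a (- b) (- c) (- - d) ⟩
    (a + - c) + (- b + - - d) ≈⟨ +-cong refl (+-comm (- b) (- - d)) ⟩
    (a + - c) + (- - d + - b) ≈⟨ +-cong refl (+-cong (-‿involutive d) refl) ⟩
    (a + - c) + (d + - b)     ∎

  [a-b]-[a-c]≈c-b : ∀ a b c → (a + - b) + - (a + - c) ≈ c + - b
  [a-b]-[a-c]≈c-b a b c =
    trans ([a-b]-[c-d]≈[a-c]+[d-b] a b a c) (trans (+-cong (-‿inverseʳ a) refl) (+-identityˡ _))

  [a-c]-[b-c]≈a-b : ∀ a b c → (a + - c) + - (b + - c) ≈ a + - b
  [a-c]-[b-c]≈a-b a b c =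
    trans ([a-b]-[c-d]≈[a-c]+[d-b] a c b c) (trans (+-cong refl (-‿inverseʳ c)) (+-identityʳ _))

  a-[a-b]≈b : ∀ a b → a + - (a + - b) ≈ b
  a-[a-b]≈b a b = begin
    a + - (a + - b)   ≈⟨ +-cong refl (-‿+-comm a (- b)) ⟨
    a + (- a + - - b) ≈⟨ +-assoc a (- a) (- - b) ⟨
    (a + - a) + - - b ≈⟨ +-cong (-‿inverseʳ a) (-‿involutive b) ⟩
    0# + b            ≈⟨ +-identityˡ b ⟩
    b                 ∎

  a-b≈c⇒a≈b+c : ∀ {a b c} → a + - b ≈ c → a ≈ b + c
  a-b≈c⇒a≈b+c {a} {b} {c} a-b≈c = begin
    a             ≈⟨ //-rightDividesˡ b a ⟨
    (a + - b) + b ≈⟨ +-cong a-b≈c refl ⟩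
    c + b         ≈⟨ +-comm c b ⟩
    b + c         ∎

  [a+b]-a≈b : ∀ a b → (a + b) + - a ≈ b
  [a+b]-a≈b a b = trans (+-cong (+-comm a b) refl) (//-rightDividesʳ a b)

  -- Spans and linear independence

  Span : ∀ {n} → List (V n) → Pred (V n) 0ℓ
  Span []      x = x ≈v 0v
  Span (v ∷ L) x = ∃[ a ] Span L (x -v a ·v v)

  Independent : ∀ {n} → List (V n) → Set
  Independent []      = ⊤
  Independent (v ∷ L) = ¬ Span L v × Independent L

  module _ {n : ℕ} where

    span-resp : ∀ (L : List (V n)) → Span L Respects _≈v_
    span-resp []      x≈y x∈L       = ≈v-trans (≈v-sym x≈y) x∈L
    span-resp (v ∷ L) x≈y (a , x∈L) = a , span-resp L (λ i → +-cong (x≈y i) refl) x∈L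

    span? : ∀ (L : List (V n)) → Decidable (Span L)
    span? []      x = x ≈v? 0v
    span? (v ∷ L) x with any? (λ a → span? L (x -v a ·v v)) elems
    ... | yes p = yes (satisfied p)
    ... | no ¬p = no λ (a , s) → ¬p (Any.map
                    (λ a≈b → span-resp L (λ i → +-cong refl (-‿cong (*-cong a≈b refl))) s) (elems-complete a))

    span-0 : ∀ (L : List (V n)) → Span L 0v
    span-0 []      = ≈v-refl
    span-0 (v ∷ L) = 0# , span-resp L (λ i → sym (x-0*y≈x 0# (v i))) (span-0 L)

    span-+ : ∀ (L : List (V n)) {x y} → Span L x → Span L y → Span L (x +v y)
    span-+ []      x∈L y∈L i = trans (+-cong (x∈L i) (y∈L i)) (+-identityʳ 0#)
    span-+ (v ∷ L) {x} {y} (a , x∈L) (b , y∈L) =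
      a + b , span-resp L (λ i → begin
        (x i + - (a · v i)) + (y i + - (b · v i)) ≈⟨ interchange (x i) _ (y i) _ ⟩
        (x i + y i) + (- (a · v i) + - (b · v i)) ≈⟨ +-cong refl (-‿+-comm _ _) ⟩
        (x i + y i) + - (a · v i + b · v i)       ≈⟨ +-cong refl (-‿cong (distribʳ (v i) a b)) ⟨
        (x i + y i) + - ((a + b) · v i)           ∎) (span-+ L x∈L y∈L)

    span-· : ∀ (L : List (V n)) c {x} → Span L x → Span L (c ·v x)
    span-· []      c x∈L i = trans (*-cong refl (x∈L i)) (zeroʳ c)
    span-· (v ∷ L) c {x} (a , x∈L) =
      c · a , span-resp L (λ i → begin
        c · (x i + - (a · v i))       ≈⟨ distribˡ c (x i) _ ⟩
        c · x i + c · - (a · v i)     ≈⟨ +-cong refl (-‿distribʳ-* c _) ⟨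
        c · x i + - (c · (a · v i))   ≈⟨ +-cong refl (-‿cong (*-assoc c a (v i))) ⟨
        c · x i + - ((c · a) · v i)   ∎) (span-· L c x∈L)

    span-- : ∀ (L : List (V n)) {x y} → Span L x → Span L y → Span L (x -v y)
    span-- L x∈L y∈L = span-+ L x∈L (span-resp L (λ i → -1*x≈-x _) (span-· L (- 1#) y∈L))

    span-∷⁺ : ∀ v (L : List (V n)) {x} → Span L x → Span (v ∷ L) x
    span-∷⁺ v L {x} x∈L = 0# , span-resp L (λ i → sym (x-0*y≈x (x i) (v i))) x∈L

    span-self : ∀ v (L : List (V n)) → Span (v ∷ L) v
    span-self v L = 1# , span-resp L (λ i → sym (x-1*x≈0 (v i))) (span-0 L)

    span-∈ : ∀ (L : List (V n)) {v} → Any (v ≡_) L → Span L v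
    span-∈ (w ∷ L) (here ≡.refl) = span-self w L
    span-∈ (w ∷ L) (there v∈L)   = span-∷⁺ w L (span-∈ L v∈L)

    span-⊆ : ∀ (L M : List (V n)) → All (Span M) L → Span L ⊆ Span M
    span-⊆ []      M _              x∈L       = span-resp M (≈v-sym x∈L) (span-0 M)
    span-⊆ (v ∷ L) M (v∈M ∷ L⊆M) {x} (a , x∈L) =
      span-resp M (λ i → //-rightDividesˡ (a · v i) (x i)) (span-+ M (span-⊆ L M L⊆M x∈L) (span-· M a v∈M))

    span-++ˡ : ∀ (L M : List (V n)) → Span L ⊆ Span (L ++ M)
    span-++ˡ L M = span-⊆ L (L ++ M) (All.tabulate (λ v∈L → span-∈ (L ++ M) (AnyP.++⁺ˡ v∈L)))

    span-++ʳ : ∀ (L M : List (V n)) → Span M ⊆ Span (L ++ M)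
    span-++ʳ L M = span-⊆ M (L ++ M) (All.tabulate (λ v∈M → span-∈ (L ++ M) (AnyP.++⁺ʳ L v∈M)))

    span-·⁻¹ : ∀ (L : List (V n)) {c v} → ¬ c ≈ 0# → Span L (c ·v v) → Span L v
    span-·⁻¹ L {c} {v} c≉0 cv∈L with inverse c c≉0
    ... | c⁻¹ , c·c⁻¹≈1 = span-resp L (λ i → begin
          c⁻¹ · (c · v i) ≈⟨ *-assoc c⁻¹ c (v i) ⟨
          (c⁻¹ · c) · v i ≈⟨ *-cong (trans (*-comm c⁻¹ c) c·c⁻¹≈1) refl ⟩
          1# · v i        ≈⟨ *-identityˡ (v i) ⟩
          v i             ∎) (span-· L c⁻¹ cv∈L)

    -- span (v ∷ L) is the disjoint union, over a ∈ F, of the translates a v + span L.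
    count-span : ∀ (L : List (V n)) → Independent L → count (span? L) ≡ q ^ length L
    count-span []      _              = count-singleton {n} 0v
    count-span (v ∷ L) (v∉L , L-ind) =
      ≡.trans (count-cong (span? (v ∷ L)) (λ x → any? (λ a → span? L (x -v a ·v v)) elems)
                 (λ (a , x∈) → Any.map (λ a≈b → span-resp L (λ i → +-cong refl (-‿cong (*-cong a≈b refl))) x∈)
                                       (elems-complete a))
                 satisfied)
     (≡.trans (count-⋃ (λ a x → span? L (x -v a ·v v)) coefficient-unique
                 (λ a → ≡.trans (count-translate (span? L) (span-resp L) (a ·v v)) (count-span L L-ind))
                 elems elems-unique)
              (≡.cong (_* q ^ length L) elems-length))
      where
      coefficient-unique : ∀ {a b x} → Span L (x -v a ·v v) → Span L (x -v b ·v v) → a ≈ b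
      coefficient-unique {a} {b} {x} x-av∈L x-bv∈L with (a + - b) ≟ 0#
      ... | yes a-b≈0 = x∙y⁻¹≈ε⇒x≈y a b a-b≈0
      ... | no a-b≉0  = ⊥-elim (v∉L (span-·⁻¹ L a-b≉0 (span-resp L (λ i → begin
            (x i + - (b · v i)) + - (x i + - (a · v i)) ≈⟨ [a-b]-[a-c]≈c-b (x i) _ _ ⟩
            a · v i + - (b · v i)                       ≈⟨ +-cong refl (-‿distribˡ-* b (v i)) ⟩
            a · v i + (- b) · v i                       ≈⟨ distribʳ (v i) a (- b) ⟨
            (a + - b) · v i                             ∎) (span-- L x-bv∈L x-av∈L))))

    independent-length≤ : ∀ (L : List (V n)) → Independent L → length L ≤ n
    independent-length≤ L L-ind = ^-cancelʳ-≤ q 1<q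
      (≡.subst₂ _≤_ (count-span L L-ind) (count-all n) (count-mono (span? L) U? _))

    independent-++ˡ : ∀ (L M : List (V n)) → Independent (L ++ M) → Independent L
    independent-++ˡ []      M _                  = tt
    independent-++ˡ (v ∷ L) M (v∉L++M , LM-ind) = v∉L++M ∘ span-++ˡ L M , independent-++ˡ L M LM-ind

    independent-++⇒disjoint : ∀ (L M : List (V n)) → Independent (L ++ M) →
      ∀ {x} → Span L x → Span M x → x ≈v 0v
    independent-++⇒disjoint []      M _                 x∈L        _   = x∈L
    independent-++⇒disjoint (v ∷ L) M (v∉L++M , LM-ind) {x} (a , x-av∈L) x∈M with a ≟ 0#
    ... | yes a≈0 = independent-++⇒disjoint L M LM-ind
                      (span-resp L (λ i → trans (+-cong refl (-‿cong (*-cong a≈0 refl))) (x-0*y≈x (x i) (v i))) x-av∈L) x∈M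
    ... | no a≉0  = ⊥-elim (v∉L++M (span-·⁻¹ (L ++ M) a≉0
                      (span-resp (L ++ M) (λ i → a-[a-b]≈b (x i) (a · v i))
                        (span-- (L ++ M) (span-++ʳ L M x∈M) (span-++ˡ L M x-av∈L)))))

    independent-span-length : ∀ (K L : List (V n)) → Independent K → Independent L →
      Span K ⊆ Span L → Span L ⊆ Span K → length K ≡ length L
    independent-span-length K L K-ind L-ind K⊆L L⊆K = ^-injectiveʳ q 1<q
      (≡.trans (≡.sym (count-span K K-ind)) (≡.trans (count-cong (span? K) (span? L) K⊆L L⊆K) (count-span L L-ind)))

    record Extension (S : Pred (V n) 0ℓ) (L : List (V n)) : Set where
      field
        new         : List (V n)
        independent : Independent (new ++ L)
        new⊆S       : All S new
        S⊆span      : S ⊆ Span (new ++ L)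

    extend : ∀ {S : Pred (V n) 0ℓ} → Decidable S → S Respects _≈v_ →
      ∀ L → Independent L → Extension S L
    extend {S} S? S-resp L L-ind = go (suc n) [] L-ind [] (ℕₚ.m≤n+m (suc n) (length L))
      where
      go : ∀ fuel M → Independent (M ++ L) → All S M → suc n ≤ length (M ++ L) ℕ.+ fuel → Extension S L
      go fuel M ML-ind M⊆S bound
        with ∃? (S? ∩? ∁? (span? (M ++ L))) (λ x≈y (sx , x∉) → S-resp x≈y sx , x∉ ∘ span-resp (M ++ L) (≈v-sym x≈y))
      ... | no ¬outside = record { new = M ; independent = ML-ind ; new⊆S = M⊆S ; S⊆span = inside }
        where
        inside : S ⊆ Span (M ++ L)
        inside {x} sx with span? (M ++ L) x
        ... | yes x∈ = x∈
        ... | no x∉  = ⊥-elim (¬outside (x , sx , x∉))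
      go ℕ.zero    M ML-ind _ bound | yes _ =
        ⊥-elim (ℕₚ.<⇒≱ (≡.subst (suc n ≤_) (ℕₚ.+-identityʳ _) bound) (independent-length≤ (M ++ L) ML-ind))
      go (suc fuel) M ML-ind M⊆S bound | yes (x , sx , x∉) =
        go fuel (x ∷ M) (x∉ , ML-ind) (sx ∷ M⊆S) (≡.subst (suc n ≤_) (ℕₚ.+-suc (length (M ++ L)) fuel) bound)

    extension-length : ∀ (K L : List (V n)) → Independent K → All (Span K) L →
      (ext : Extension (Span K) L) → length (Extension.new ext) ℕ.+ length L ≡ length K
    extension-length K L K-ind L⊆K ext = ≡.trans (≡.sym (length-++ new))
      (independent-span-length (new ++ L) K independent K-ind
        (span-⊆ (new ++ L) K (All.++⁺ new⊆S L⊆K)) S⊆span)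
      where open Extension ext

    independent-prefix : ∀ d (L : List (V n)) → d ≤ length L → Independent L →
      Σ[ u ∈ (Fin d → V n) ] Independent (tabulate u) × Span (tabulate u) ⊆ Span L
    independent-prefix ℕ.zero  L       _           _              =
      (λ ()) , tt , λ x≈0 → span-resp L (≈v-sym x≈0) (span-0 L)
    independent-prefix (suc d) (v ∷ L) (s≤s d≤|L|) (v∉L , L-ind) with independent-prefix d L d≤|L| L-ind
    ... | u , u-ind , u⊆L = (v ∷ᶠ u) , (v∉L ∘ u⊆L , u-ind) , λ (a , x-av∈u) → a , u⊆L x-av∈u

  module _ {n k : ℕ} where

    inSpan⇒span : ∀ (u : Fin k → V n) → InSpan F u ⊆ Span (tabulate u)
    inSpan⇒span u (c , x≈Σcu) = go u c x≈Σcu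
      where
      go : ∀ {k} (u : Fin k → V n) c {x} → x ≈v lincomb F u c → Span (tabulate u) x
      go {ℕ.zero} u c x≈0     = x≈0
      go {suc k}  u c x≈Σcu = c zero , go (u ∘ suc) (c ∘ suc) (λ j → trans (+-cong (x≈Σcu j) refl) ([a+b]-a≈b _ _))

    span⇒inSpan : ∀ (u : Fin k → V n) → Span (tabulate u) ⊆ InSpan F u
    span⇒inSpan u = go u
      where
      go : ∀ {k} (u : Fin k → V n) → Span (tabulate u) ⊆ InSpan F u
      go {ℕ.zero} u x≈0 = (λ ()) , x≈0
      go {suc k}  u (a , x-au∈) with go (u ∘ suc) x-au∈
      ... | c , x-au≈Σcu = (a ∷ᶠ c) , λ j → a-b≈c⇒a≈b+c (x-au≈Σcu j)

    inCoset⇒span : ∀ v (u : Fin k → V n) {x} → InCoset F v u x → Span (tabulate u) (x -v v)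
    inCoset⇒span v u (c , x≈v+Σcu) = inSpan⇒span u (c , λ j → trans (+-cong (x≈v+Σcu j) refl) ([a+b]-a≈b _ _))

    span⇒inCoset : ∀ v (u : Fin k → V n) {x} → Span (tabulate u) (x -v v) → InCoset F v u x
    span⇒inCoset v u x-v∈u with span⇒inSpan u x-v∈u
    ... | c , x-v≈Σcu = c , λ j → a-b≈c⇒a≈b+c (x-v≈Σcu j)

  -- Quadratic forms

  module QuadraticForm {n : ℕ} (Q : V n → Carrier) (isQ : IsQuadraticForm F Q) where
    open IsQuadraticForm isQ

    B : V n → V n → Carrier
    B = polar F Q

    B-sym : ∀ x y → B x y ≈ B y x
    B-sym x y = begin
      (Q (x +v y) + - Q x) + - Q y ≈⟨ +-assoc _ _ _ ⟩
      Q (x +v y) + (- Q x + - Q y) ≈⟨ +-cong (Q-cong (λ i → +-comm (x i) (y i))) (+-comm _ _) ⟩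
      Q (y +v x) + (- Q y + - Q x) ≈⟨ +-assoc _ _ _ ⟨
      (Q (y +v x) + - Q y) + - Q x ∎

    B-congˡ : ∀ {x x′} y → x ≈v x′ → B x y ≈ B x′ y
    B-congˡ y x≈x′ = +-cong (+-cong (Q-cong (λ i → +-cong (x≈x′ i) refl)) (-‿cong (Q-cong x≈x′))) refl

    B-congʳ : ∀ x {y y′} → y ≈v y′ → B x y ≈ B x y′
    B-congʳ x {y} {y′} y≈y′ = trans (B-sym x y) (trans (B-congˡ x y≈y′) (B-sym y′ x))

    B-+ʳ : ∀ w x y → B w (x +v y) ≈ B w x + B w y
    B-+ʳ w x y = trans (B-sym w _) (trans (B-additive x y w) (+-cong (B-sym x w) (B-sym y w)))

    B-·ʳ : ∀ a w x → B w (a ·v x) ≈ a · B w x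
    B-·ʳ a w x = trans (B-sym w _) (trans (B-homog a x w) (*-cong refl (B-sym x w)))

    B-negʳ : ∀ w x → B w (λ i → - x i) ≈ - B w x
    B-negʳ w x = trans (B-congʳ w (λ i → sym (-1*x≈-x (x i)))) (trans (B-·ʳ (- 1#) w x) (-1*x≈-x _))

    B--ʳ : ∀ w x y → B w (x -v y) ≈ B w x + - B w y
    B--ʳ w x y = trans (B-+ʳ w x _) (+-cong refl (B-negʳ w y))

    B--ˡ : ∀ x y w → B (x -v y) w ≈ B x w + - B y w
    B--ˡ x y w = trans (B-sym _ w) (trans (B--ʳ w x y) (+-cong (B-sym w x) (-‿cong (B-sym w y))))

    B-0ʳ : ∀ w {x} → x ≈v 0v → B w x ≈ 0#
    B-0ʳ w {x} x≈0 = begin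
      B w x           ≈⟨ B-congʳ w (λ i → trans (x≈0 i) (sym (zeroˡ 0#))) ⟩
      B w (0# ·v 0v)  ≈⟨ B-·ʳ 0# w 0v ⟩
      0# · B w 0v     ≈⟨ zeroˡ _ ⟩
      0#              ∎

    Q-+ : ∀ x y → Q (x +v y) ≈ (Q x + Q y) + B x y
    Q-+ x y = begin
      Q (x +v y)                                   ≈⟨ //-rightDividesˡ (Q x + Q y) _ ⟨
      (Q (x +v y) + - (Q x + Q y)) + (Q x + Q y)   ≈⟨ +-comm _ _ ⟩
      (Q x + Q y) + (Q (x +v y) + - (Q x + Q y))   ≈⟨ +-cong refl (+-cong refl (-‿+-comm (Q x) (Q y))) ⟨
      (Q x + Q y) + (Q (x +v y) + (- Q x + - Q y)) ≈⟨ +-cong refl (+-assoc _ _ _) ⟨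
      (Q x + Q y) + B x y                          ∎

    Q-neg : ∀ x → Q (λ i → - x i) ≈ Q x
    Q-neg x = begin
      Q (λ i → - x i)         ≈⟨ Q-cong (λ i → sym (-1*x≈-x (x i))) ⟩
      Q ((- 1#) ·v x)         ≈⟨ Q-scale (- 1#) x ⟩
      ((- 1#) · (- 1#)) · Q x ≈⟨ *-cong (trans (-1*x≈-x (- 1#)) (-‿involutive 1#)) refl ⟩
      1# · Q x                ≈⟨ *-identityˡ (Q x) ⟩
      Q x                     ∎

    Q-- : ∀ x y → Q (x -v y) ≈ (Q x + Q y) + - B x y
    Q-- x y = trans (Q-+ x (λ i → - y i)) (+-cong (+-cong refl (Q-neg y)) (B-negʳ x y))

    infix 4 _⟂_
    _⟂_ : V n → Pred (V n) 0ℓ → Set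
    x ⟂ S = ∀ {s} → S s → B x s ≈ 0#

    TotallySingular : Pred (V n) 0ℓ → Set
    TotallySingular S = ∀ {x} → S x → Q x ≈ 0#

    -- The consequence of maximality that the argument uses (see U-maximal).
    MaximalSingular : List (V n) → Set
    MaximalSingular U = ∀ {x} → Q x ≈ 0# → x ⟂ Span U → Span U x

    ⟂-span : ∀ w (L : List (V n)) → All (λ b → B w b ≈ 0#) L → w ⟂ Span L
    ⟂-span w []      _            s≈0         = B-0ʳ w s≈0
    ⟂-span w (v ∷ L) (w⟂v ∷ w⟂L) {s} (a , s-av∈L) = begin
      B w s                           ≈⟨ B-congʳ w (λ i → //-rightDividesˡ (a · v i) (s i)) ⟨
      B w ((s -v a ·v v) +v a ·v v)   ≈⟨ B-+ʳ w _ _ ⟩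
      B w (s -v a ·v v) + B w (a ·v v) ≈⟨ +-cong (⟂-span w L w⟂L s-av∈L) (trans (B-·ʳ a w v) (*-cong refl w⟂v)) ⟩
      0# + a · 0#                     ≈⟨ trans (+-identityˡ _) (zeroʳ a) ⟩
      0#                              ∎

    singular⇒⟂ : ∀ (L : List (V n)) → TotallySingular (Span L) → ∀ {x} → Span L x → x ⟂ Span L
    singular⇒⟂ L L-singular {x} x∈L {y} y∈L = begin
      (Q (x +v y) + - Q x) + - Q y ≈⟨ +-cong (+-cong (L-singular (span-+ L x∈L y∈L)) (-‿cong (L-singular x∈L))) (-‿cong (L-singular y∈L)) ⟩
      (0# + - 0#) + - 0#           ≈⟨ +-cong (-‿inverseʳ 0#) -0#≈0# ⟩
      0# + 0#                      ≈⟨ +-identityʳ 0# ⟩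
      0#                           ∎

    ∃-nonzero-⟂ : ∀ (K L : List (V n)) → Independent L → length K ℕ.< length L →
      ∃[ z ] Span L z × ¬ z ≈v 0v × All (λ b → B z b ≈ 0#) K
    ∃-nonzero-⟂ K L L-ind |K|<|L|
      with pigeonhole (span? L) (span-resp L) (λ x j → B x (lookup K j)) (λ x≈y j → B-congˡ _ x≈y)
             (≡.subst (q ^ length K ℕ.<_) (≡.sym (count-span L L-ind)) (ℕₚ.^-monoʳ-< q 1<q |K|<|L|))
    ... | x , y , x∈L , y∈L , x≉y , Bx≈By =
      x -v y , span-- L x∈L y∈L ,
      (λ x-y≈0 → x≉y (λ i → x∙y⁻¹≈ε⇒x≈y (x i) (y i) (x-y≈0 i))) ,
      tabulate-lookup K (λ j → trans (B--ˡ x y _) (x≈y⇒x∙y⁻¹≈ε (Bx≈By j)))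
      where
      tabulate-lookup : ∀ (L : List (V n)) {P : Pred (V n) 0ℓ} → (∀ j → P (lookup L j)) → All P L
      tabulate-lookup []      _  = []
      tabulate-lookup (v ∷ L) pL = pL zero ∷ tabulate-lookup L (pL ∘ suc)

    singular-length≤maximal : ∀ (U W : List (V n)) →
      Independent U → TotallySingular (Span U) → MaximalSingular U →
      Independent W → TotallySingular (Span W) → length W ≤ length U
    singular-length≤maximal U W U-ind U-singular U-maximal W-ind W-singular = ℕₚ.≮⇒≥ absurd
      where
      module E = Extension (extend (span? U ∩? span? W)
                   (λ x≈y (x∈U , x∈W) → span-resp U x≈y x∈U , span-resp W x≈y x∈W) [] tt)
      E = E.new ++ []
      E⊆U∩W : All (Span U ∩ Span W) E
      E⊆U∩W = All.++⁺ E.new⊆S []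
      U′-ext = extend (span? U) (span-resp U) E E.independent
      W′-ext = extend (span? W) (span-resp W) E E.independent
      module U′ = Extension U′-ext
      module W′ = Extension W′-ext

      shorter-complement : length U ℕ.< length W → length U′.new ℕ.< length W′.new
      shorter-complement |U|<|W| = ℕₚ.+-cancelʳ-< (length E) _ _ (≡.subst₂ ℕ._<_
        (≡.sym (extension-length U E U-ind (All.map proj₁ E⊆U∩W) U′-ext))
        (≡.sym (extension-length W E W-ind (All.map proj₂ E⊆U∩W) W′-ext))
        |U|<|W|)

      -- A nonzero z in the complement W′ of U ∩ W, orthogonal to the complement U′, is singular and
      -- orthogonal to all of U, so maximality puts it in U ∩ W = span E, which meets span W′ only in 0.
      absurd : length U ℕ.< length W → ⊥
      absurd |U|<|W| =
        nonzero-⟂-contradiction (∃-nonzero-⟂ U′.new W′.new (independent-++ˡ W′.new E W′.independent)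
                                                            (shorter-complement |U|<|W|))
        where
        nonzero-⟂-contradiction : ∃[ z ] Span W′.new z × ¬ z ≈v 0v × All (λ b → B z b ≈ 0#) U′.new → ⊥
        nonzero-⟂-contradiction (z , z∈W′ , z≉0 , z⟂U′) =
          z≉0 (independent-++⇒disjoint W′.new E W′.independent z∈W′ (E.S⊆span (z∈U , z∈W)))
          where
          z∈W : Span W z
          z∈W = span-⊆ (W′.new ++ E) W (All.++⁺ W′.new⊆S (All.map proj₂ E⊆U∩W)) (span-++ˡ W′.new E z∈W′)
          z⟂U : z ⟂ Span U
          z⟂U u∈U = ⟂-span z (U′.new ++ E)
            (All.++⁺ z⟂U′ (All.map (singular⇒⟂ W W-singular z∈W ∘ proj₂) E⊆U∩W)) (U′.S⊆span u∈U)
          z∈U : Span U z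
          z∈U = U-maximal (W-singular z∈W) z⟂U

    count-fibre : ∀ (L : List (V n)) → Independent L → ∀ w {s₀} → Span L s₀ → ¬ B w s₀ ≈ 0# → ∀ c →
      count (span? L ∩? (λ y → B w y ≟ c)) ≡ q ^ (length L ∸ 1)
    count-fibre L L-ind w {s₀} s₀∈L Bws₀≉0 c = cancel (length L) (≡.trans (≡.sym q*fibre) (count-span L L-ind))
      where
      Fibre : Carrier → Pred (V n) 0ℓ
      Fibre a y = Span L y × B w y ≈ a
      fibre? : ∀ a → Decidable (Fibre a)
      fibre? a = span? L ∩? (λ y → B w y ≟ a)
      fibre-resp : ∀ a → Fibre a Respects _≈v_
      fibre-resp a x≈y (x∈L , Bwx≈a) = span-resp L x≈y x∈L , trans (sym (B-congʳ w x≈y)) Bwx≈a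

      -- translating by a multiple of s₀ moves the value of B w by any prescribed amount
      same-size : ∀ a → count (fibre? a) ≡ count (fibre? c)
      same-size a with inverse (B w s₀) Bws₀≉0
      ... | β , Bws₀·β≈1 = ≡.trans (count-cong (fibre? a) (λ y → fibre? c (y -v t)) to from)
                                  (count-translate (fibre? c) (fibre-resp c) t)
        where
        t = ((a + - c) · β) ·v s₀
        t∈L : Span L t
        t∈L = span-· L _ s₀∈L
        Bwt≈a-c : B w t ≈ a + - c
        Bwt≈a-c = begin
          B w t                         ≈⟨ B-·ʳ _ w s₀ ⟩
          ((a + - c) · β) · B w s₀      ≈⟨ *-assoc _ β _ ⟩
          (a + - c) · (β · B w s₀)      ≈⟨ *-cong refl (trans (*-comm β _) Bws₀·β≈1) ⟩
          (a + - c) · 1#                ≈⟨ *-identityʳ _ ⟩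
          a + - c                       ∎
        to : Fibre a ⊆ (λ y → Fibre c (y -v t))
        to {y} (y∈L , Bwy≈a) = span-- L y∈L t∈L ,
          trans (B--ʳ w y t) (trans (+-cong Bwy≈a (-‿cong Bwt≈a-c)) (a-[a-b]≈b a c))
        from : (λ y → Fibre c (y -v t)) ⊆ Fibre a
        from {y} (y-t∈L , Bw[y-t]≈c) =
          span-resp L (λ i → //-rightDividesˡ (t i) (y i)) (span-+ L y-t∈L t∈L) ,
          (begin
            B w y                   ≈⟨ a-b≈c⇒a≈b+c (trans (sym (B--ʳ w y t)) Bw[y-t]≈c) ⟩
            B w t + c               ≈⟨ +-cong Bwt≈a-c refl ⟩
            (a + - c) + c           ≈⟨ //-rightDividesˡ c a ⟩
            a                       ∎)

      q*fibre : count (span? L) ≡ q * count (fibre? c)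
      q*fibre = ≡.trans (count-cong (span? L) (λ y → any? (λ a → fibre? a y) elems)
                          (λ {y} y∈L → Any.map (λ Bwy≈a → y∈L , Bwy≈a) (elems-complete (B w y)))
                          (proj₁ ∘ proj₂ ∘ satisfied))
               (≡.trans (count-⋃ fibre? (λ (_ , Bwy≈a) (_ , Bwy≈b) → trans (sym Bwy≈a) Bwy≈b) same-size elems elems-unique)
                        (≡.cong (_* count (fibre? c)) elems-length))

      cancel : ∀ d → q * count (fibre? c) ≡ q ^ d → count (fibre? c) ≡ q ^ (d ∸ 1)
      cancel ℕ.zero  q*k≡1   = ⊥-elim (ℕₚ.<⇒≢ 1<q (≡.sym (ℕₚ.m*n≡1⇒m≡1 q _ q*k≡1)))
      cancel (suc d) q*k≡q^d = ℕₚ.*-cancelˡ-≡ _ _ q {{ℕ.>-nonZero (ℕₚ.<-trans (s≤s z≤n) 1<q)}} q*k≡q^d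

    Neighbour : V n → Pred (V n) 0ℓ
    Neighbour w y = ¬ y ≈v w × Q (w -v y) ≈ 0#

    neighbour? : ∀ w → Decidable (Neighbour w)
    neighbour? w y = ¬? (y ≈v? w) ×-dec (Q (w -v y) ≟ 0#)

    Q-[w-y] : ∀ w {y} → Q y ≈ 0# → Q (w -v y) ≈ Q w + - B w y
    Q-[w-y] w {y} Qy≈0 = trans (Q-- w y) (+-cong (trans (+-cong refl Qy≈0) (+-identityʳ _)) refl)

    module _ (U : List (V n)) (U-singular : TotallySingular (Span U)) where

      count-neighbours-∈ : Independent U → ∀ {w} → Span U w →
        count (span? U ∩? neighbour? w) ≡ q ^ length U ∸ 1
      count-neighbours-∈ U-ind {w} w∈U =
        ≡.trans (count-cong (span? U ∩? neighbour? w) (span? U ∩? ∁? (_≈v? w))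
                  (λ (y∈U , y≉w , _) → y∈U , y≉w)
                  (λ (y∈U , y≉w) → y∈U , y≉w , U-singular (span-- U w∈U y∈U)))
       (≡.trans (≡.sym (ℕₚ.m+n∸m≡n 1 _))
       (≡.trans (≡.cong (λ k → k ℕ.+ count (span? U ∩? ∁? (_≈v? w)) ∸ 1) (≡.sym only-w))
       (≡.trans (≡.cong (_∸ 1) (≡.sym (count-split (span? U) (_≈v? w))))
                (≡.cong (_∸ 1) (count-span U U-ind)))))
        where
        only-w : count (span? U ∩? (_≈v? w)) ≡ 1
        only-w = ≡.trans (count-cong (span? U ∩? (_≈v? w)) (_≈v? w) proj₂
                           (λ y≈w → span-resp U (≈v-sym y≈w) w∈U , y≈w))
                         (count-singleton w)

      count-neighbours-not⟂ : Independent U → ∀ {w s₀} → Span U s₀ → ¬ B w s₀ ≈ 0# →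
        count (span? U ∩? neighbour? w) ≡ q ^ (length U ∸ 1)
      count-neighbours-not⟂ U-ind {w} s₀∈U Bws₀≉0 =
        ≡.trans (count-cong (span? U ∩? neighbour? w) (span? U ∩? (λ y → B w y ≟ Q w))
                  (λ (y∈U , _ , Q[w-y]≈0) →
                     y∈U , sym (x∙y⁻¹≈ε⇒x≈y _ _ (trans (sym (Q-[w-y] w (U-singular y∈U))) Q[w-y]≈0)))
                  (λ (y∈U , Bwy≈Qw) →
                     y∈U ,
                     (λ y≈w → Bws₀≉0 (singular⇒⟂ U U-singular (span-resp U y≈w y∈U) s₀∈U)) ,
                     trans (Q-[w-y] w (U-singular y∈U)) (x≈y⇒x∙y⁻¹≈ε (sym Bwy≈Qw))))
                (count-fibre U U-ind w s₀∈U Bws₀≉0 (Q w))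

      count-neighbours-⟂∉ : MaximalSingular U → ∀ {w} → w ⟂ Span U → ¬ Span U w →
        count (span? U ∩? neighbour? w) ≡ 0
      count-neighbours-⟂∉ U-maximal {w} w⟂U w∉U =
        count-none (span? U ∩? neighbour? w) λ y (y∈U , _ , Q[w-y]≈0) → w∉U (U-maximal (begin
          Q w            ≈⟨ +-identityʳ (Q w) ⟨
          Q w + 0#       ≈⟨ +-cong refl (trans (-‿cong (w⟂U y∈U)) -0#≈0#) ⟨
          Q w + - B w y  ≈⟨ Q-[w-y] w (U-singular y∈U) ⟨
          Q (w -v y)     ≈⟨ Q[w-y]≈0 ⟩
          0#             ∎) w⟂U)

    singular-∷ : ∀ (L : List (V n)) → TotallySingular (Span L) → ∀ {x} → Q x ≈ 0# → x ⟂ Span L →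
      TotallySingular (Span (x ∷ L))
    singular-∷ L L-singular {x} Qx≈0 x⟂L {y} (a , y-ax∈L) = begin
      Q y                                                        ≈⟨ Q-cong (λ i → //-rightDividesˡ (a · x i) (y i)) ⟨
      Q ((y -v a ·v x) +v a ·v x)                                 ≈⟨ Q-+ _ _ ⟩
      (Q (y -v a ·v x) + Q (a ·v x)) + B (y -v a ·v x) (a ·v x)  ≈⟨ +-cong (+-cong (L-singular y-ax∈L) Q[ax]≈0) B[y-ax,ax]≈0 ⟩
      (0# + 0#) + 0#                                             ≈⟨ trans (+-identityʳ _) (+-identityʳ 0#) ⟩
      0#                                                         ∎
      where
      Q[ax]≈0 = trans (Q-scale a x) (trans (*-cong refl Qx≈0) (zeroʳ _))
      B[y-ax,ax]≈0 = trans (B-·ʳ a _ x) (trans (*-cong refl (trans (B-sym _ x) (x⟂L y-ax∈L))) (zeroʳ a))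

    module _ {k : ℕ} (u : Fin k → V n) where

      linIndep⇒independent : LinIndep F Q u → Independent (tabulate u)
      linIndep⇒independent = go u
        where
        go : ∀ {k} (u : Fin k → V n) → LinIndep F Q u → Independent (tabulate u)
        go {ℕ.zero} u _       = tt
        go {suc k}  u u-indep = u₀∉ , go (u ∘ suc) tail-indep
          where
          tail-indep : LinIndep F Q (u ∘ suc)
          tail-indep c Σcu≈0 i =
            u-indep (0# ∷ᶠ c) (λ j → trans (+-cong (zeroˡ (u zero j)) (Σcu≈0 j)) (+-identityˡ 0#)) (suc i)
          u₀∉ : ¬ Span (tabulate (u ∘ suc)) (u zero)
          u₀∉ u₀∈ with span⇒inSpan (u ∘ suc) u₀∈
          ... | c , u₀≈Σcu = 0≉1 (sym (trans (sym (-‿involutive 1#)) (trans (-‿cong -1≈0) -0#≈0#)))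
            where
            -1≈0 : - 1# ≈ 0#
            -1≈0 = u-indep ((- 1#) ∷ᶠ c)
              (λ j → trans (+-cong (-1*x≈-x (u zero j)) (sym (u₀≈Σcu j))) (-‿inverseˡ (u zero j))) zero

      independent⇒linIndep : Independent (tabulate u) → LinIndep F Q u
      independent⇒linIndep = go u
        where
        go : ∀ {k} (u : Fin k → V n) → Independent (tabulate u) → LinIndep F Q u
        go {ℕ.zero} u _                  c _     ()
        go {suc k}  u (u₀∉ , tail-ind) c Σcu≈0 = c≈0
          where
          c₀≈0 : c zero ≈ 0#
          c₀≈0 with c zero ≟ 0#
          ... | yes c₀≈0 = c₀≈0
          ... | no c₀≉0  = ⊥-elim (u₀∉ (span-·⁻¹ (tabulate (u ∘ suc)) c₀≉0
                  (span-resp (tabulate (u ∘ suc)) (λ j → trans (-1*x≈-x _) (sym (+-inverseˡ-unique _ _ (Σcu≈0 j))))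
                    (span-· (tabulate (u ∘ suc)) (- 1#) (inSpan⇒span (u ∘ suc) ((c ∘ suc) , λ j → refl))))))
          c≈0 : ∀ i → c i ≈ 0#
          c≈0 zero    = c₀≈0
          c≈0 (suc i) = go (u ∘ suc) tail-ind (c ∘ suc)
            (λ j → trans (sym (+-identityˡ _)) (trans (+-cong (sym (trans (*-cong c₀≈0 refl) (zeroˡ _))) refl) (Σcu≈0 j))) i

    maximal-length : ∀ d → HasTSSubspaceOfDim F Q d → ¬ HasTSSubspaceOfDim F Q (suc d) →
      ∀ (U : List (V n)) → Independent U → TotallySingular (Span U) → MaximalSingular U → length U ≡ d
    maximal-length d (W , W-indep , W-singular) ¬has-d+1 U U-ind U-singular U-maximal =
      ℕₚ.≤-antisym (ℕₚ.≮⇒≥ d≮|U|) d≤|U|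
      where
      d≤|U| : d ≤ length U
      d≤|U| = ≡.subst (_≤ length U) (length-tabulate W)
        (singular-length≤maximal U (tabulate W) U-ind U-singular U-maximal
          (linIndep⇒independent W W-indep) (λ x∈W → W-singular _ (span⇒inSpan W x∈W)))
      d≮|U| : ¬ d ℕ.< length U
      d≮|U| d<|U| with independent-prefix (suc d) U d<|U| U-ind
      ... | u , u-ind , u⊆U =
        ¬has-d+1 (u , independent⇒linIndep u u-ind , λ _ x∈u → U-singular (u⊆U (inSpan⇒span u x∈u)))

    ¬⟂⇒∃ : ∀ (L : List (V n)) {w} → ¬ w ⟂ Span L → ∃[ s ] Span L s × ¬ B w s ≈ 0#
    ¬⟂⇒∃ L {w} w⟂̸L with ∃? (span? L ∩? ∁? (λ s → B w s ≟ 0#))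
                          (λ x≈y (x∈L , Bwx≉0) → span-resp L x≈y x∈L , Bwx≉0 ∘ trans (B-congʳ w x≈y))
    ... | yes witness = witness
    ... | no ¬witness = ⊥-elim (w⟂̸L λ {s} s∈L → decidable-stable (B w s ≟ 0#) (λ Bws≉0 → ¬witness (s , s∈L , Bws≉0)))

    neighbour-resp : ∀ w → Neighbour w Respects _≈v_
    neighbour-resp w x≈y (x≉w , Q[w-x]≈0) =
      x≉w ∘ ≈v-trans x≈y , trans (Q-cong (λ i → +-cong refl (-‿cong (sym (x≈y i))))) Q[w-x]≈0

    module MaximalSubspace {k : ℕ} (u : Fin k → V n) (u-maximal : MaximalTotSingular F Q u) where
      private
        module Basis = Extension (extend (span? (tabulate u)) (span-resp (tabulate u)) [] tt)

      U : List (V n)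
      U = Basis.new ++ []

      U-independent : Independent U
      U-independent = Basis.independent

      U⊆u : Span U ⊆ Span (tabulate u)
      U⊆u = span-⊆ U (tabulate u) (All.++⁺ Basis.new⊆S [])

      u⊆U : Span (tabulate u) ⊆ Span U
      u⊆U = Basis.S⊆span

      u-singular : TotallySingular (Span (tabulate u))
      u-singular x∈u = proj₁ u-maximal _ (span⇒inSpan u x∈u)

      U-singular : TotallySingular (Span U)
      U-singular = u-singular ∘ U⊆u

      U-maximal : MaximalSingular U
      U-maximal {x} Qx≈0 x⟂U = u⊆U (inSpan⇒span u
        (proj₂ u-maximal (suc k) (x ∷ᶠ u) x∷u-singular u⊆x∷u x (span⇒inSpan (x ∷ᶠ u) (span-self x (tabulate u)))))
        where
        x∷u-singular : TotSingular F Q (x ∷ᶠ u)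
        x∷u-singular _ = singular-∷ (tabulate u) u-singular Qx≈0 (x⟂U ∘ u⊆U) ∘ inSpan⇒span (x ∷ᶠ u)
        u⊆x∷u : ∀ y → InSpan F u y → InSpan F (x ∷ᶠ u) y
        u⊆x∷u _ = span⇒inSpan (x ∷ᶠ u) ∘ span-∷⁺ x (tabulate u) ∘ inSpan⇒span u

      count-neighbours-coset : ∀ v z → countNbrsInCoset F Q v u z ≡ count (span? U ∩? neighbour? (z -v v))
      count-neighbours-coset v z =
        ≡.trans (count-cong (InCoset? F v u ∩? neighbour? z) (λ x → (span? U ∩? neighbour? (z -v v)) (x -v v))
                  (λ {x} (x∈v+u , x≉z , Q[z-x]≈0) →
                     u⊆U (inCoset⇒span v u x∈v+u) ,
                     (λ x-v≈z-v → x≉z (λ i → +-cancelʳ (- v i) _ _ (x-v≈z-v i))) ,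
                     trans (Q-cong (λ i → [a-c]-[b-c]≈a-b (z i) (x i) (v i))) Q[z-x]≈0)
                  (λ {x} (x-v∈U , x-v≉z-v , Q[[z-v]-[x-v]]≈0) →
                     span⇒inCoset v u (U⊆u x-v∈U) ,
                     (λ x≈z → x-v≉z-v (λ i → +-cong (x≈z i) refl)) ,
                     trans (Q-cong (λ i → sym ([a-c]-[b-c]≈a-b (z i) (x i) (v i)))) Q[[z-v]-[x-v]]≈0))
                (count-translate (span? U ∩? neighbour? (z -v v))
                  (λ x≈y (x∈U , x-nbr) → span-resp U x≈y x∈U , neighbour-resp (z -v v) x≈y x-nbr) v)

      inPerpCoset⇒⟂ : ∀ {v z} → InPerpCoset F Q v u z → z -v v ⟂ Span U
      inPerpCoset⇒⟂ {v} {z} (y , y⟂u , z≈v+y) s∈U =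
        trans (B-congˡ _ (λ i → trans (+-cong (z≈v+y i) refl) ([a+b]-a≈b (v i) (y i)))) (y⟂u _ (span⇒inSpan u (U⊆u s∈U)))

      ⟂⇒inPerpCoset : ∀ {v z} → z -v v ⟂ Span U → InPerpCoset F Q v u z
      ⟂⇒inPerpCoset {v} {z} z-v⟂U = z -v v , (λ _ → z-v⟂U ∘ u⊆U ∘ inSpan⇒span u) , λ i → a-b≈c⇒a≈b+c refl

lemma15 : ∀ {q : ℕ} (F : FiniteField q) (m : ℕ) → 1 ≤ m →
    (Q : Vec F (2 * m) → FiniteField.Carrier F) →
    IsQuadraticForm F Q → Nondegenerate F Q → Elliptic F m Q →
    (v : Vec F (2 * m)) {k : ℕ} (u : Fin k → Vec F (2 * m)) →
    MaximalTotSingular F Q u →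
    (z : Vec F (2 * m)) →
    (InCoset F v u z → countNbrsInCoset F Q v u z ≡ q ^ (m ∸ 1) ∸ 1)
    × (¬ InPerpCoset F Q v u z → countNbrsInCoset F Q v u z ≡ q ^ (m ∸ 2))
    × (InPerpCoset F Q v u z → ¬ InCoset F v u z → countNbrsInCoset F Q v u z ≡ 0)
lemma15 F ℕ.zero () Q
lemma15 {q} F (suc m) _ Q isQ _ (has-m , ¬has-1+m) v u u-maximal z =
  on-coset , off-perp-coset , on-perp-coset-off-coset
  where
  open FiniteVectorSpace F
  open QuadraticForm Q isQ
  open MaximalSubspace u u-maximal

  neighbours : ℕ
  neighbours = count (span? U ∩? neighbour? (z -v v))

  dim-U : length U ≡ m
  dim-U = maximal-length m has-m ¬has-1+m U U-independent U-singular U-maximal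

  on-coset : InCoset F v u z → countNbrsInCoset F Q v u z ≡ q ^ m ∸ 1
  on-coset z∈v+u = ≡.trans (count-neighbours-coset v z) (≡.subst (λ d → neighbours ≡ q ^ d ∸ 1) dim-U
    (count-neighbours-∈ U U-singular U-independent (u⊆U (inCoset⇒span v u z∈v+u))))

  off-perp-coset : ¬ InPerpCoset F Q v u z → countNbrsInCoset F Q v u z ≡ q ^ (m ∸ 1)
  off-perp-coset z∉v+U⊥ with ¬⟂⇒∃ U (z∉v+U⊥ ∘ ⟂⇒inPerpCoset)
  ... | s₀ , s₀∈U , Bws₀≉0 = ≡.trans (count-neighbours-coset v z) (≡.subst (λ d → neighbours ≡ q ^ (d ∸ 1)) dim-U
    (count-neighbours-not⟂ U U-singular U-independent s₀∈U Bws₀≉0))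

  on-perp-coset-off-coset : InPerpCoset F Q v u z → ¬ InCoset F v u z → countNbrsInCoset F Q v u z ≡ 0
  on-perp-coset-off-coset z∈v+U⊥ z∉v+u = ≡.trans (count-neighbours-coset v z)
    (count-neighbours-⟂∉ U U-singular U-maximal (inPerpCoset⇒⟂ z∈v+U⊥) (z∉v+u ∘ span⇒inCoset v u ∘ U⊆u))
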